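{- D-Frege+$\forall$red is refutationally complete for S-form DQBFs: every false S-form DQBF has a D-Frege+$\forall$red refutation.
   Context: An S-form DQBF is a formula $\forall U\exists E\,\phi$ where $U$ is a finite set of universal variables, $E$ a finite set of existential variables, each $x\in E$ carries a dependency set $D_x\subseteq U$, and $\phi$ is a quantifier-free propositional formula over $U\cup E$. For a universal variable $u$ set $D_u=\{u\}$. The DQBF is true iff there are functions $f_x:\{0,1\}^{D_x}\to\{0,1\}$ ($x\in E$) such that for every assignment $\tau$ to $U$, $\tau$ extended by $x\mapsto f_x(\tau|_{D_x})$ satisfies $\phi$; otherwise it is false. D-Frege+$\forall$red: a refutation of $\forall U\exists E\,\phi$ is a sequence of propositional formulas ending in the constant $0$, each obtained by one of: (Frege) an axiom or rule of a fixed Frege system applied to earlier lines; (Axiom) a conjunct of $\phi$; (IndExt) a formula $\alpha\to(v\leftrightarrow\bigwedge_{y\in Y}y)$ or $\alpha\to(v\leftrightarrow\bigvee_{y\in Y}y)$, where $\alpha$ is a conjunction of universal literals, $Y$ a set of literals of existing variables, and $v$ a fresh variable added as existential with $D_v=(\bigcup_{y\in Y}D_{\mathrm{var}(y)})\setminus\mathrm{var}(\alpha)$; ($\forall$-red) from an earlier line $L(u)$ derive $L(0)$ or $L(1)$, where $u$ is universal and no existential variable $x$ occurring in $L$ has $u\in D_x$; (prefix weakening) the prefix may be extended by a new variable not occurring in the matrix. -}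

module Defs where

open import Data.Bool using (Bool; true; false; if_then_else_; not; _∧_; _∨_)
open import Data.Nat using (ℕ; _≡ᵇ_)
open import Data.List using (List; []; _∷_; _++_; map; concatMap; foldr)
open import Data.List.Membership.Propositional using (_∈_; _∉_)
open import Data.List.Relation.Unary.All using (All)
open import Data.List.Relation.Unary.Unique.Propositional using (Unique)
open import Data.Product using (_×_; _,_; proj₁; proj₂; Σ)
open import Data.Maybe using (Maybe; just; nothing; maybe)
open import Relation.Binary.PropositionalEquality using (_≡_)
open import Relation.Nullary using (¬_)

data Form : Set where
  cst  : Bool → Form
  var  : ℕ → Form
  neg  : Form → Form
  _∧ᶠ_ : Form → Form → Form
  _∨ᶠ_ : Form → Form → Form
  _⇒ᶠ_ : Form → Form → Form
  _⇔ᶠ_ : Form → Form → Form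

Assignment : Set
Assignment = ℕ → Bool

iffB : Bool → Bool → Bool
iffB b c = if b then c else not c

⟦_⟧ : Form → Assignment → Bool
⟦ cst b ⟧ ρ = b
⟦ var x ⟧ ρ = ρ x
⟦ neg A ⟧ ρ = not (⟦ A ⟧ ρ)
⟦ A ∧ᶠ B ⟧ ρ = ⟦ A ⟧ ρ ∧ ⟦ B ⟧ ρ
⟦ A ∨ᶠ B ⟧ ρ = ⟦ A ⟧ ρ ∨ ⟦ B ⟧ ρ
⟦ A ⇒ᶠ B ⟧ ρ = not (⟦ A ⟧ ρ) ∨ ⟦ B ⟧ ρ
⟦ A ⇔ᶠ B ⟧ ρ = iffB (⟦ A ⟧ ρ) (⟦ B ⟧ ρ)

vars : Form → List ℕ
vars (cst b) = []
vars (var x) = x ∷ []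
vars (neg A) = vars A
vars (A ∧ᶠ B) = vars A ++ vars B
vars (A ∨ᶠ B) = vars A ++ vars B
vars (A ⇒ᶠ B) = vars A ++ vars B
vars (A ⇔ᶠ B) = vars A ++ vars B

inst : (ℕ → Form) → Form → Form
inst σ (cst b) = cst b
inst σ (var x) = σ x
inst σ (neg A) = neg (inst σ A)
inst σ (A ∧ᶠ B) = inst σ A ∧ᶠ inst σ B
inst σ (A ∨ᶠ B) = inst σ A ∨ᶠ inst σ B
inst σ (A ⇒ᶠ B) = inst σ A ⇒ᶠ inst σ B
inst σ (A ⇔ᶠ B) = inst σ A ⇔ᶠ inst σ B

setVar : ℕ → Bool → Form → Form
setVar u b = inst (λ x → if x ≡ᵇ u then cst b else var x)

conjuncts : Form → List Form
conjuncts (A ∧ᶠ B) = conjuncts A ++ conjuncts B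
conjuncts A = A ∷ []

Lit : Set
Lit = ℕ × Bool

lit : Lit → Form
lit (x , true) = var x
lit (x , false) = neg (var x)

bigAnd : List Form → Form
bigAnd = foldr _∧ᶠ_ (cst true)

bigOr : List Form → Form
bigOr = foldr _∨ᶠ_ (cst false)

_⊨_ : List Form → Form → Set
Γ ⊨ B = ∀ (ρ : Assignment) → All (λ A → ⟦ A ⟧ ρ ≡ true) Γ → ⟦ B ⟧ ρ ≡ true

record Rule : Set where
  constructor rule
  field
    premises   : List Form
    conclusion : Form
open Rule public

data Proves (rules : List Rule) (Γ : List Form) : Form → Set where
  hyp : ∀ {B} → B ∈ Γ → Proves rules Γ B
  app : ∀ {r} → r ∈ rules → (σ : ℕ → Form) →
        All (λ A → Proves rules Γ (inst σ A)) (premises r) →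
        Proves rules Γ (inst σ (conclusion r))

record FregeSystem : Set where
  field
    rules    : List Rule
    sound    : ∀ r → r ∈ rules → ∀ (σ : ℕ → Form) →
               map (inst σ) (premises r) ⊨ inst σ (conclusion r)
    complete : ∀ (Γ : List Form) (B : Form) → Γ ⊨ B → Proves rules Γ B
open FregeSystem public

elem : ℕ → List ℕ → Bool
elem x [] = false
elem x (y ∷ ys) = (x ≡ᵇ y) ∨ elem x ys

record Prefix : Set where
  constructor pfx
  field
    univ : List ℕ
    exis : List (ℕ × List ℕ)     -- existential variables x with D_x
open Prefix public

pvars : Prefix → List ℕ
pvars P = univ P ++ map proj₁ (exis P)

lookupDep : List (ℕ × List ℕ) → ℕ → Maybe (List ℕ)
lookupDep [] x = nothing
lookupDep ((y , D) ∷ E) x = if x ≡ᵇ y then just D else lookupDep E x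

depsOf : Prefix → ℕ → List ℕ
depsOf P x = if elem x (univ P) then x ∷ [] else maybe (λ D → D) [] (lookupDep (exis P) x)

removeAll : List ℕ → List ℕ → List ℕ
removeAll xs [] = []
removeAll xs (y ∷ ys) = if elem y xs then removeAll xs ys else y ∷ removeAll xs ys

addU : Prefix → ℕ → Prefix
addU P v = pfx (univ P ++ v ∷ []) (exis P)

addE : Prefix → ℕ → List ℕ → Prefix
addE P v D = pfx (univ P) (exis P ++ (v , D) ∷ [])

record DQBF : Set where
  constructor dqbf
  field
    prefix : Prefix
    matrix : Form
open DQBF public

WellFormed : DQBF → Set
WellFormed Q =
  Unique (pvars (prefix Q)) ×
  All (λ xD → All (_∈ univ (prefix Q)) (proj₂ xD)) (exis (prefix Q)) ×
  All (_∈ pvars (prefix Q)) (vars (matrix Q))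

restrict : List ℕ → Assignment → Assignment
restrict D τ v = if elem v D then τ v else false

extend : List (ℕ × List ℕ) → (ℕ → Assignment → Bool) → Assignment → Assignment
extend E f τ v with lookupDep E v
... | just D  = f v (restrict D τ)
... | nothing = τ v

IsTrue : DQBF → Set
IsTrue Q = Σ (ℕ → Assignment → Bool) λ f →
  ∀ (τ : Assignment) → ⟦ matrix Q ⟧ (extend (exis (prefix Q)) f τ) ≡ true

-- D-Frege+∀red derivations.  Deriv F Q P L : the lines L (most recent
-- first) are derivable from Q, with current (extended) prefix P.

data Deriv (F : FregeSystem) (Q : DQBF) : Prefix → List Form → Set where
  start  : Deriv F Q (prefix Q) []
  frege  : ∀ {P L r} → Deriv F Q P L → r ∈ rules F → (σ : ℕ → Form) →
           All (λ A → inst σ A ∈ L) (premises r) →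
           Deriv F Q P (inst σ (conclusion r) ∷ L)
  axiom  : ∀ {P L ψ} → Deriv F Q P L → ψ ∈ conjuncts (matrix Q) →
           Deriv F Q P (ψ ∷ L)
  indExtAnd : ∀ {P L} → Deriv F Q P L →
           (α : List Lit) → All (λ l → proj₁ l ∈ univ P) α →
           (Y : List Lit) → All (λ l → proj₁ l ∈ pvars P) Y →
           (v : ℕ) → v ∉ pvars P → v ∉ vars (matrix Q) → All (λ A → v ∉ vars A) L →
           Deriv F Q (addE P v (removeAll (map proj₁ α) (concatMap (λ l → depsOf P (proj₁ l)) Y)))
             ((bigAnd (map lit α) ⇒ᶠ (var v ⇔ᶠ bigAnd (map lit Y))) ∷ L)
  indExtOr : ∀ {P L} → Deriv F Q P L →
           (α : List Lit) → All (λ l → proj₁ l ∈ univ P) α →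
           (Y : List Lit) → All (λ l → proj₁ l ∈ pvars P) Y →
           (v : ℕ) → v ∉ pvars P → v ∉ vars (matrix Q) → All (λ A → v ∉ vars A) L →
           Deriv F Q (addE P v (removeAll (map proj₁ α) (concatMap (λ l → depsOf P (proj₁ l)) Y)))
             ((bigAnd (map lit α) ⇒ᶠ (var v ⇔ᶠ bigOr (map lit Y))) ∷ L)
  ∀red   : ∀ {P L A} → Deriv F Q P L → A ∈ L → (u : ℕ) → u ∈ univ P →
           (∀ x D → x ∈ vars A → lookupDep (exis P) x ≡ just D → u ∉ D) →
           (b : Bool) → Deriv F Q P (setVar u b A ∷ L)
  weakU  : ∀ {P L} → Deriv F Q P L → (v : ℕ) → v ∉ pvars P → v ∉ vars (matrix Q) →
           Deriv F Q (addU P v) L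
  weakE  : ∀ {P L} → Deriv F Q P L → (v : ℕ) → v ∉ pvars P → v ∉ vars (matrix Q) →
           (D : List ℕ) → All (_∈ univ P) D → Deriv F Q (addE P v D) L

Refutation : FregeSystem → DQBF → Set
Refutation F Q = Σ Prefix λ P → Σ (List Form) λ L → Deriv F Q P (cst false ∷ L)

-- For every existential x and every assignment α to D_x, IndExt
-- introduces x^α with the line  α → (x^α ↔ x);  its dependency set D_x ∖ D_x is empty.  For every
-- assignment g to U, the matrix with each x replaced by x^(g|D_x) follows from the axioms and these lines
-- under the hypothesis U = g, so Frege derives  (U = g) → φ[x^(g|D_x)/x];  ∀-reduction, legal since every
-- existential left has an empty dependency set, then fixes U to g.  A model of all the resulting formulas
-- would give Skolem functions f_x(α) = x^α for Q, so they are unsatisfiable and the implicational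
-- completeness of Frege derives 0 from them.

module Submission where

open import Defs

open import Data.Bool using (Bool; true; false; if_then_else_; not; _∧_; _∨_)
import Data.Bool.Properties as Bool
open import Data.Empty using (⊥-elim)
open import Data.List using (List; []; _∷_; _++_; map; concatMap)
open import Data.List.Extrema.Nat using (max; xs≤max)
open import Data.List.Membership.Propositional using (_∈_; _∉_; find)
open import Data.List.Membership.Propositional.Properties
  using (∈-++⁺ˡ; ∈-++⁺ʳ; ∈-++⁻; ∈-map⁺; ∈-map⁻; ∈-concatMap⁺; ∈-concatMap⁻)
import Data.List.Properties as List
open import Data.List.Relation.Binary.Subset.Propositional using (_⊆_)
open import Data.List.Relation.Unary.All as All using (All; []; _∷_)
import Data.List.Relation.Unary.All.Properties as All
open import Data.List.Relation.Unary.Any as Any using (here; there)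
open import Data.List.Relation.Unary.AllPairs using (_∷_)
open import Data.List.Relation.Unary.Unique.Propositional using (Unique)
open import Data.Maybe using (Maybe; just; nothing; fromMaybe)
open import Data.Nat using (ℕ; suc; _+_; _≤_; _<_; _≡ᵇ_; s≤s)
import Data.Nat.Properties as ℕ
open import Data.Product using (_×_; _,_; proj₁; proj₂)
import Data.Product.Properties as Product
open import Data.Sum using (inj₁; inj₂; [_,_]′)
open import Function using (_∘_; id)
open import Relation.Binary.PropositionalEquality
  using (_≡_; refl; sym; trans; cong; cong₂; subst; module ≡-Reasoning)
open import Relation.Binary.Definitions using (DecidableEquality)
open import Relation.Nullary using (¬_; yes; no; proof)
open import Relation.Nullary.Reflects using (Reflects; ofʸ; ofⁿ)

-- ℕ's _≟_ is built from _≡ᵇ_, so its proof component already reflects m ≡ᵇ n.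
≡ᵇ-reflects : ∀ m n → Reflects (m ≡ n) (m ≡ᵇ n)
≡ᵇ-reflects m n = proof (m ℕ.≟ n)

elem-∈ : ∀ {y xs} → y ∈ xs → elem y xs ≡ true
elem-∈ {y} {x ∷ xs} y∈ with y ≡ᵇ x | ≡ᵇ-reflects y x
... | true  | _        = refl
... | false | ofⁿ y≢x = elem-∈ (Any.tail y≢x y∈)

elem-∉ : ∀ {y xs} → y ∉ xs → elem y xs ≡ false
elem-∉ {y} {[]}     _  = refl
elem-∉ {y} {x ∷ xs} y∉ with y ≡ᵇ x | ≡ᵇ-reflects y x
... | true  | ofʸ refl = ⊥-elim (y∉ (here refl))
... | false | _        = elem-∉ (y∉ ∘ there)

unique-++-disjoint : ∀ (xs : List ℕ) {ys y} → Unique (xs ++ ys) → y ∈ xs → y ∉ ys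
unique-++-disjoint (x ∷ xs) (x∉ ∷ _) (here refl) y∈ys = All.lookup x∉ (∈-++⁺ʳ xs y∈ys) refl
unique-++-disjoint (x ∷ xs) (_ ∷ u)  (there y∈xs)    = unique-++-disjoint xs u y∈xs

<⇒∉ : ∀ {v xs} → All (_< v) xs → v ∉ xs
<⇒∉ xs<v v∈xs = ℕ.<-irrefl refl (All.lookup xs<v v∈xs)

removeAll-⊆ : ∀ {xs ys} → ys ⊆ xs → removeAll xs ys ≡ []
removeAll-⊆ {ys = []}     _    = refl
removeAll-⊆ {ys = y ∷ ys} ys⊆xs rewrite elem-∈ (ys⊆xs (here refl)) = removeAll-⊆ (ys⊆xs ∘ there)

restrict-∈ : ∀ {D u} τ → u ∈ D → restrict D τ u ≡ τ u
restrict-∈ τ u∈D rewrite elem-∈ u∈D = refl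

_[_≔_] : Assignment → ℕ → Bool → Assignment
(ρ [ u ≔ b ]) y = if y ≡ᵇ u then b else ρ y

override : List Lit → Assignment → Assignment
override []            ρ = ρ
override ((u , b) ∷ α) ρ = override α ρ [ u ≔ b ]

valuation : List Lit → Assignment
valuation α = override α (λ _ → false)

minterm : List ℕ → Assignment → List Lit
minterm D g = map (λ u → u , g u) D

minterms : List ℕ → List (List Lit)
minterms []      = [] ∷ []
minterms (u ∷ D) = map ((u , true) ∷_) (minterms D) ++ map ((u , false) ∷_) (minterms D)

minterm∈minterms : ∀ D g → minterm D g ∈ minterms D
minterm∈minterms []      g = here refl
minterm∈minterms (u ∷ D) g with g u
... | true  = ∈-++⁺ˡ (∈-map⁺ _ (minterm∈minterms D g))
... | false = ∈-++⁺ʳ _ (∈-map⁺ _ (minterm∈minterms D g))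

vars-minterm : ∀ D g → map proj₁ (minterm D g) ≡ D
vars-minterm D g = trans (sym (List.map-∘ D)) (List.map-id D)

vars-minterms : ∀ D {α} → α ∈ minterms D → map proj₁ α ≡ D
vars-minterms []      (here refl) = refl
vars-minterms (u ∷ D) α∈ = [ cons , cons ]′ (∈-++⁻ _ α∈)
  where
  cons : ∀ {b α} → α ∈ map ((u , b) ∷_) (minterms D) → map proj₁ α ≡ u ∷ D
  cons α∈ with ∈-map⁻ _ α∈
  ... | _ , α′∈ , refl = cong (u ∷_) (vars-minterms D α′∈)

override-minterm-∈ : ∀ D g ρ {u} → u ∈ D → override (minterm D g) ρ u ≡ g u
override-minterm-∈ (u′ ∷ D) g ρ {u} u∈ with u ≡ᵇ u′ | ≡ᵇ-reflects u u′
... | true  | ofʸ refl = refl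
... | false | ofⁿ u≢u′ = override-minterm-∈ D g ρ (Any.tail u≢u′ u∈)

override-minterm-∉ : ∀ D g ρ {y} → y ∉ D → override (minterm D g) ρ y ≡ ρ y
override-minterm-∉ []      g ρ _  = refl
override-minterm-∉ (u ∷ D) g ρ {y} y∉ with y ≡ᵇ u | ≡ᵇ-reflects y u
... | true  | ofʸ refl = ⊥-elim (y∉ (here refl))
... | false | _        = override-minterm-∉ D g ρ (y∉ ∘ there)

⟦inst⟧ : ∀ σ A ρ → ⟦ inst σ A ⟧ ρ ≡ ⟦ A ⟧ (λ y → ⟦ σ y ⟧ ρ)
⟦inst⟧ σ (cst b)  ρ = refl
⟦inst⟧ σ (var x)  ρ = refl
⟦inst⟧ σ (neg A)  ρ = cong not (⟦inst⟧ σ A ρ)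
⟦inst⟧ σ (A ∧ᶠ B) ρ = cong₂ _∧_ (⟦inst⟧ σ A ρ) (⟦inst⟧ σ B ρ)
⟦inst⟧ σ (A ∨ᶠ B) ρ = cong₂ _∨_ (⟦inst⟧ σ A ρ) (⟦inst⟧ σ B ρ)
⟦inst⟧ σ (A ⇒ᶠ B) ρ = cong₂ (λ a b → not a ∨ b) (⟦inst⟧ σ A ρ) (⟦inst⟧ σ B ρ)
⟦inst⟧ σ (A ⇔ᶠ B) ρ = cong₂ iffB (⟦inst⟧ σ A ρ) (⟦inst⟧ σ B ρ)

⟦⟧-local : ∀ A {ρ ρ′} → (∀ {y} → y ∈ vars A → ρ y ≡ ρ′ y) → ⟦ A ⟧ ρ ≡ ⟦ A ⟧ ρ′
⟦⟧-local (cst b)  eq = refl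
⟦⟧-local (var x)  eq = eq (here refl)
⟦⟧-local (neg A)  eq = cong not (⟦⟧-local A eq)
⟦⟧-local (A ∧ᶠ B) eq = cong₂ _∧_ (⟦⟧-local A (eq ∘ ∈-++⁺ˡ)) (⟦⟧-local B (eq ∘ ∈-++⁺ʳ (vars A)))
⟦⟧-local (A ∨ᶠ B) eq = cong₂ _∨_ (⟦⟧-local A (eq ∘ ∈-++⁺ˡ)) (⟦⟧-local B (eq ∘ ∈-++⁺ʳ (vars A)))
⟦⟧-local (A ⇒ᶠ B) eq =
  cong₂ (λ a b → not a ∨ b) (⟦⟧-local A (eq ∘ ∈-++⁺ˡ)) (⟦⟧-local B (eq ∘ ∈-++⁺ʳ (vars A)))
⟦⟧-local (A ⇔ᶠ B) eq = cong₂ iffB (⟦⟧-local A (eq ∘ ∈-++⁺ˡ)) (⟦⟧-local B (eq ∘ ∈-++⁺ʳ (vars A)))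

vars-inst : ∀ {P : ℕ → Set} σ A → (∀ {z} → z ∈ vars A → All P (vars (σ z))) → All P (vars (inst σ A))
vars-inst σ (cst b)  h = []
vars-inst σ (var x)  h = h (here refl)
vars-inst σ (neg A)  h = vars-inst σ A h
vars-inst σ (A ∧ᶠ B) h = All.++⁺ (vars-inst σ A (h ∘ ∈-++⁺ˡ)) (vars-inst σ B (h ∘ ∈-++⁺ʳ (vars A)))
vars-inst σ (A ∨ᶠ B) h = All.++⁺ (vars-inst σ A (h ∘ ∈-++⁺ˡ)) (vars-inst σ B (h ∘ ∈-++⁺ʳ (vars A)))
vars-inst σ (A ⇒ᶠ B) h = All.++⁺ (vars-inst σ A (h ∘ ∈-++⁺ˡ)) (vars-inst σ B (h ∘ ∈-++⁺ʳ (vars A)))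
vars-inst σ (A ⇔ᶠ B) h = All.++⁺ (vars-inst σ A (h ∘ ∈-++⁺ˡ)) (vars-inst σ B (h ∘ ∈-++⁺ʳ (vars A)))

⟦setVar⟧ : ∀ u b A ρ → ⟦ setVar u b A ⟧ ρ ≡ ⟦ A ⟧ (ρ [ u ≔ b ])
⟦setVar⟧ u b A ρ = trans (⟦inst⟧ _ A ρ) (⟦⟧-local A (λ {y} _ → substituted y))
  where
  substituted : ∀ y → ⟦ if y ≡ᵇ u then cst b else var y ⟧ ρ ≡ (ρ [ u ≔ b ]) y
  substituted y with y ≡ᵇ u
  ... | true  = refl
  ... | false = refl

vars-setVar : ∀ u b A → vars (setVar u b A) ⊆ vars A
vars-setVar u b A = All.lookup (vars-inst _ A (λ {z} → substituted z))
  where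
  substituted : ∀ z → z ∈ vars A → All (_∈ vars A) (vars (if z ≡ᵇ u then cst b else var z))
  substituted z z∈A with z ≡ᵇ u
  ... | true  = []
  ... | false = z∈A ∷ []

setVars : List Lit → Form → Form
setVars []            A = A
setVars ((u , b) ∷ α) A = setVars α (setVar u b A)

⟦setVars⟧ : ∀ α A ρ → ⟦ setVars α A ⟧ ρ ≡ ⟦ A ⟧ (override α ρ)
⟦setVars⟧ []            A ρ = refl
⟦setVars⟧ ((u , b) ∷ α) A ρ = trans (⟦setVars⟧ α (setVar u b A) ρ) (⟦setVar⟧ u b A (override α ρ))

⟦conjuncts⟧ : ∀ A ρ → All (λ B → ⟦ B ⟧ ρ ≡ true) (conjuncts A) → ⟦ A ⟧ ρ ≡ true
⟦conjuncts⟧ (A ∧ᶠ B) ρ h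
  rewrite ⟦conjuncts⟧ A ρ (All.++⁻ˡ (conjuncts A) h) | ⟦conjuncts⟧ B ρ (All.++⁻ʳ (conjuncts A) h) = refl
⟦conjuncts⟧ (cst b)  ρ (h ∷ []) = h
⟦conjuncts⟧ (var x)  ρ (h ∷ []) = h
⟦conjuncts⟧ (neg A)  ρ (h ∷ []) = h
⟦conjuncts⟧ (A ∨ᶠ B) ρ (h ∷ []) = h
⟦conjuncts⟧ (A ⇒ᶠ B) ρ (h ∷ []) = h
⟦conjuncts⟧ (A ⇔ᶠ B) ρ (h ∷ []) = h

vars-conjuncts : ∀ A {B} → B ∈ conjuncts A → vars B ⊆ vars A
vars-conjuncts (A ∧ᶠ A′) B∈ with ∈-++⁻ (conjuncts A) B∈
... | inj₁ B∈A  = ∈-++⁺ˡ ∘ vars-conjuncts A B∈A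
... | inj₂ B∈A′ = ∈-++⁺ʳ (vars A) ∘ vars-conjuncts A′ B∈A′
vars-conjuncts (cst b)  (here refl) = id
vars-conjuncts (var x)  (here refl) = id
vars-conjuncts (neg A)  (here refl) = id
vars-conjuncts (A ∨ᶠ B) (here refl) = id
vars-conjuncts (A ⇒ᶠ B) (here refl) = id
vars-conjuncts (A ⇔ᶠ B) (here refl) = id

Agrees : Assignment → List Lit → Set
Agrees ρ α = All (λ l → ρ (proj₁ l) ≡ proj₂ l) α

⟦bigAnd⟧⁻ : ∀ α ρ → ⟦ bigAnd (map lit α) ⟧ ρ ≡ true → Agrees ρ α
⟦bigAnd⟧⁻ []              ρ _ = []
⟦bigAnd⟧⁻ ((x , true) ∷ α)  ρ h with ρ x in ρx
... | true  = ρx ∷ ⟦bigAnd⟧⁻ α ρ h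
⟦bigAnd⟧⁻ ((x , false) ∷ α) ρ h with ρ x in ρx
... | false = ρx ∷ ⟦bigAnd⟧⁻ α ρ h

⟦bigAnd⟧⁺ : ∀ α ρ → Agrees ρ α → ⟦ bigAnd (map lit α) ⟧ ρ ≡ true
⟦bigAnd⟧⁺ []              ρ []         = refl
⟦bigAnd⟧⁺ ((x , true) ∷ α)  ρ (ρx ∷ h) rewrite ρx = ⟦bigAnd⟧⁺ α ρ h
⟦bigAnd⟧⁺ ((x , false) ∷ α) ρ (ρx ∷ h) rewrite ρx = ⟦bigAnd⟧⁺ α ρ h

vars-bigAnd : ∀ α → vars (bigAnd (map lit α)) ⊆ map proj₁ α
vars-bigAnd ((x , true) ∷ α)  (here refl) = here refl
vars-bigAnd ((x , false) ∷ α) (here refl) = here refl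
vars-bigAnd ((x , true) ∷ α)  (there y∈)  = there (vars-bigAnd α y∈)
vars-bigAnd ((x , false) ∷ α) (there y∈)  = there (vars-bigAnd α y∈)

⇒ᶠ-elim : ∀ A B ρ → ⟦ A ⇒ᶠ B ⟧ ρ ≡ true → ⟦ A ⟧ ρ ≡ true → ⟦ B ⟧ ρ ≡ true
⇒ᶠ-elim A B ρ A⇒B A-true rewrite A-true = A⇒B

⇒ᶠ-intro : ∀ A B ρ → (⟦ A ⟧ ρ ≡ true → ⟦ B ⟧ ρ ≡ true) → ⟦ A ⇒ᶠ B ⟧ ρ ≡ true
⇒ᶠ-intro A B ρ A→B with ⟦ A ⟧ ρ
... | true  = A→B refl
... | false = refl

iffB-true : ∀ {b c} → iffB b c ≡ true → b ≡ c
iffB-true {true}  {true}  _ = refl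
iffB-true {false} {false} _ = refl

lookupDep-∈ : ∀ E {y D} → lookupDep E y ≡ just D → (y , D) ∈ E
lookupDep-∈ ((x , D′) ∷ E) {y} eq with y ≡ᵇ x | ≡ᵇ-reflects y x
lookupDep-∈ ((x , D′) ∷ E) refl | true  | ofʸ refl = here refl
lookupDep-∈ ((x , D′) ∷ E) eq   | false | _        = there (lookupDep-∈ E eq)

lookupDep-∉ : ∀ E {y} → lookupDep E y ≡ nothing → y ∉ map proj₁ E
lookupDep-∉ ((x , D) ∷ E) {y} eq y∈ with y ≡ᵇ x | ≡ᵇ-reflects y x
lookupDep-∉ ((x , D) ∷ E) () y∈ | true  | _
lookupDep-∉ ((x , D) ∷ E) eq y∈ | false | ofⁿ y≢x = lookupDep-∉ E eq (Any.tail y≢x y∈)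

lookupDep-++ˡ : ∀ E E′ {y D} → lookupDep E y ≡ just D → lookupDep (E ++ E′) y ≡ just D
lookupDep-++ˡ ((x , D′) ∷ E) E′ {y} eq with y ≡ᵇ x
... | true  = eq
... | false = lookupDep-++ˡ E E′ eq

lookupDep-++ʳ : ∀ E E′ {y} → y ∉ map proj₁ E → lookupDep (E ++ E′) y ≡ lookupDep E′ y
lookupDep-++ʳ []            E′ _  = refl
lookupDep-++ʳ ((x , D) ∷ E) E′ {y} y∉ with y ≡ᵇ x | ≡ᵇ-reflects y x
... | true  | ofʸ refl = ⊥-elim (y∉ (here refl))
... | false | _        = lookupDep-++ʳ E E′ (y∉ ∘ there)

lookupDep-independent : ∀ vs {y D} → lookupDep (map (_, []) vs) y ≡ just D → D ≡ []
lookupDep-independent (v ∷ vs) {y} eq with y ≡ᵇ v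
lookupDep-independent (v ∷ vs) refl | true  = refl
lookupDep-independent (v ∷ vs) eq   | false = lookupDep-independent vs eq

-- Every universal variable can be ∀-reduced in A.
Unconstrained : Prefix → Form → Set
Unconstrained P A = ∀ {x D} → x ∈ vars A → lookupDep (exis P) x ≡ just D → D ≡ []

module Derivations (F : FregeSystem) (Q : DQBF) where

  record Extension (P : Prefix) (L : List Form) (Goal : List Form → Set) : Set where
    constructor extension
    field
      {lines} : List Form
      deriv   : Deriv F Q P lines
      keeps   : L ⊆ lines
      goal    : Goal lines

  _⟫=_ : ∀ {P L G H} → Extension P L G →
         (∀ {L′} → L ⊆ L′ → Deriv F Q P L′ → G L′ → Extension P L′ H) → Extension P L H
  extension d L⊆L′ g ⟫= k with k L⊆L′ d g
  ... | extension d′ L′⊆L″ h = extension d′ (L′⊆L″ ∘ L⊆L′) h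

  unchanged : ∀ {P L G} → Deriv F Q P L → G L → Extension P L G
  unchanged d g = extension d id g

  mutual
    replay : ∀ {Γ B P L} → Proves (rules F) Γ B → Γ ⊆ L → Deriv F Q P L → Extension P L (B ∈_)
    replay (hyp B∈Γ) Γ⊆L d = unchanged d (Γ⊆L B∈Γ)
    replay (app r∈F σ ps) Γ⊆L d =
      replayAll ps Γ⊆L d ⟫= λ _ d′ premises → extension (frege d′ r∈F σ premises) there (here refl)

    replayAll : ∀ {Γ σ ps P L} → All (λ A → Proves (rules F) Γ (inst σ A)) ps → Γ ⊆ L → Deriv F Q P L →
                Extension P L (λ L′ → All (λ A → inst σ A ∈ L′) ps)
    replayAll []       Γ⊆L d = unchanged d []
    replayAll (p ∷ ps) Γ⊆L d =
      replay p Γ⊆L d ⟫= λ L⊆L₁ d₁ p∈L₁ →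
      replayAll ps (L⊆L₁ ∘ Γ⊆L) d₁ ⟫= λ L₁⊆L₂ d₂ ps∈L₂ →
      unchanged d₂ (L₁⊆L₂ p∈L₁ ∷ ps∈L₂)

  derive-entailed : ∀ {P L B} → Deriv F Q P L → L ⊨ B → Extension P L (B ∈_)
  derive-entailed d L⊨B = replay (complete F _ _ L⊨B) id d

  derive-each : ∀ {A : Set} {P L₀} (line : A → Form) →
                (∀ a {L} → L₀ ⊆ L → Deriv F Q P L → Extension P L (line a ∈_)) →
                ∀ as {L} → L₀ ⊆ L → Deriv F Q P L → Extension P L (λ L′ → All (λ a → line a ∈ L′) as)
  derive-each line derive []       L₀⊆L d = unchanged d []
  derive-each line derive (a ∷ as) L₀⊆L d =
    derive a L₀⊆L d ⟫= λ L⊆L₁ d₁ a∈L₁ →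
    derive-each line derive as (L⊆L₁ ∘ L₀⊆L) d₁ ⟫= λ L₁⊆L₂ d₂ as∈L₂ →
    unchanged d₂ (L₁⊆L₂ a∈L₁ ∷ as∈L₂)

  ∀red-all : ∀ {P} α → All (λ l → proj₁ l ∈ univ P) α → ∀ {A L} →
             Unconstrained P A → A ∈ L → Deriv F Q P L → Extension P L (setVars α A ∈_)
  ∀red-all []            _           _    A∈L d = unchanged d A∈L
  ∀red-all ((u , b) ∷ α) (u∈U ∷ α⊆U) {A} free A∈L d
    with ∀red-all α α⊆U (free ∘ vars-setVar u b A) (here refl)
                  (∀red d A∈L u u∈U (λ _ _ x∈A eq → subst (u ∉_) (sym (free x∈A eq)) λ ()) b)
  ... | extension d′ uL⊆L′ reduced = extension d′ (uL⊆L′ ∘ there) reduced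

  axioms : ∀ {cs} → cs ⊆ conjuncts (matrix Q) → Deriv F Q (prefix Q) cs
  axioms {[]}     _      = start
  axioms {c ∷ cs} cs⊆φ = axiom (axioms (cs⊆φ ∘ there)) (cs⊆φ (here refl))

  -- A refutation must end with 0; ∀-reducing a fresh universal in an earlier line 0 re-derives it last.
  refutation : ∀ {P L} v → v ∉ pvars P → v ∉ vars (matrix Q) → Deriv F Q P L → cst false ∈ L →
               Refutation F Q
  refutation {P} v v∉P v∉φ d 0∈L =
    addU P v , _ , ∀red (weakU d v v∉P v∉φ) 0∈L v (∈-++⁺ʳ (univ P) (here refl)) (λ _ _ ()) false

module Expansion (F : FregeSystem) (Q : DQBF) (wf : WellFormed Q) where
  open Derivations F Q
  open ≡-Reasoning

  U : List ℕ
  U = univ (prefix Q)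

  E : List (ℕ × List ℕ)
  E = exis (prefix Q)

  X : List ℕ
  X = map proj₁ E

  φ : Form
  φ = matrix Q

  U∩X : ∀ {y} → y ∈ U → y ∉ X
  U∩X = unique-++-disjoint U (proj₁ wf)

  lookupDep⇒∈X : ∀ {x D} → lookupDep E x ≡ just D → x ∈ X
  lookupDep⇒∈X eq = ∈-map⁺ proj₁ (lookupDep-∈ E eq)

  lookupDep⇒⊆U : ∀ {x D} → lookupDep E x ≡ just D → D ⊆ U
  lookupDep⇒⊆U eq = All.lookup (All.lookup (proj₁ (proj₂ wf)) (lookupDep-∈ E eq))

  Dep : ℕ → List ℕ
  Dep x = fromMaybe [] (lookupDep E x)

  Dep-just : ∀ {x D} → lookupDep E x ≡ just D → Dep x ≡ D
  Dep-just = cong (fromMaybe [])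

  Dep⊆U : ∀ x → Dep x ⊆ U
  Dep⊆U x with lookupDep E x in eq
  ... | just D  = lookupDep⇒⊆U eq
  ... | nothing = λ ()

  N : ℕ
  N = suc (max 0 ((U ++ X) ++ vars φ))

  <N : ∀ {y} → y ∈ (U ++ X) ++ vars φ → y < N
  <N y∈ = s≤s (All.lookup (xs≤max 0 _) y∈)

  U<N : ∀ {y} → y ∈ U → y < N
  U<N = <N ∘ ∈-++⁺ˡ ∘ ∈-++⁺ˡ

  X<N : ∀ {y} → y ∈ X → y < N
  X<N = <N ∘ ∈-++⁺ˡ ∘ ∈-++⁺ʳ U

  φ<N : ∀ {y} → y ∈ vars φ → y < N
  φ<N = <N ∘ ∈-++⁺ʳ (U ++ X)

  -- The copy x^α of an existential x, as in universal expansion: α is an assignment to D_x.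
  Copy : Set
  Copy = ℕ × List Lit

  _≟ᶜ_ : DecidableEquality Copy
  _≟ᶜ_ = Product.≡-dec ℕ._≟_ (List.≡-dec (Product.≡-dec ℕ._≟_ Bool._≟_))

  ValidCopy : Copy → Set
  ValidCopy (x , α) = x ∈ X × α ∈ minterms (Dep x)

  copies : List Copy
  copies = concatMap (λ x → map (x ,_) (minterms (Dep x))) X

  ∈-copies⁺ : ∀ {x} g → x ∈ X → (x , minterm (Dep x) g) ∈ copies
  ∈-copies⁺ {x} g x∈X =
    ∈-concatMap⁺ _ (Any.map (λ { refl → ∈-map⁺ (x ,_) (minterm∈minterms (Dep x) g) }) x∈X)

  ∈-copies⁻ : ∀ {c} → c ∈ copies → ValidCopy c
  ∈-copies⁻ c∈ with find (∈-concatMap⁻ _ {xs = X} c∈)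
  ... | x , x∈X , c∈x with ∈-map⁻ (x ,_) c∈x
  ...   | α , α∈ , refl = x∈X , α∈

  position : Copy → List Copy → ℕ
  position c []        = 0
  position c (c′ ∷ cs) with c ≟ᶜ c′
  ... | yes _ = 0
  ... | no  _ = suc (position c cs)

  indicator : Copy → ℕ
  indicator c = N + position c copies

  indicator∉U : ∀ c → indicator c ∉ U
  indicator∉U c i∈U = ℕ.<⇒≱ (U<N i∈U) (ℕ.m≤m+n N _)

  indicator∉X : ∀ c → indicator c ∉ X
  indicator∉X c i∈X = ℕ.<⇒≱ (X<N i∈X) (ℕ.m≤m+n N _)

  indicatorLine : ℕ → Copy → Form
  indicatorLine v (x , α) = bigAnd (map lit α) ⇒ᶠ (var v ⇔ᶠ bigAnd (map lit ((x , true) ∷ [])))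

  indicatorLine-value : ∀ ρ v x α → ⟦ indicatorLine v (x , α) ⟧ ρ ≡ true → Agrees ρ α → ρ v ≡ ρ x
  indicatorLine-value ρ v x α line ρ⊨α = begin
    ρ v          ≡⟨ iffB-true (⇒ᶠ-elim (bigAnd (map lit α)) (var v ⇔ᶠ (var x ∧ᶠ cst true)) ρ line
                                       (⟦bigAnd⟧⁺ α ρ ρ⊨α)) ⟩
    ρ x ∧ true   ≡⟨ Bool.∧-identityʳ (ρ x) ⟩
    ρ x          ∎

  extended : List ℕ → Prefix
  extended vs = pfx U (E ++ map (_, []) vs)

  pvars-extended : ∀ vs → pvars (extended vs) ≡ U ++ X ++ vs
  pvars-extended vs = cong (U ++_) (begin
    map proj₁ (E ++ map (_, []) vs)         ≡⟨ List.map-++ proj₁ E _ ⟩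
    X ++ map proj₁ (map (_, []) vs)         ≡⟨ cong (X ++_) (sym (List.map-∘ vs)) ⟩
    X ++ map id vs                          ≡⟨ cong (X ++_) (List.map-id vs) ⟩
    X ++ vs                                 ∎)

  extended-snoc : ∀ vs v → addE (extended vs) v [] ≡ extended (vs ++ v ∷ [])
  extended-snoc vs v =
    cong (pfx U) (trans (List.++-assoc E _ _) (cong (E ++_) (sym (List.map-++ _ vs _))))

  depsOf-extended : ∀ vs {x} → x ∈ X → depsOf (extended vs) x ≡ Dep x
  depsOf-extended vs {x} x∈X with lookupDep E x in eq
  ... | just D  rewrite elem-∉ (λ x∈U → U∩X x∈U x∈X) | lookupDep-++ˡ E (map (_, []) vs) eq = refl
  ... | nothing = ⊥-elim (lookupDep-∉ E eq x∈X)

  Bounded : ℕ → List ℕ → List Form → Set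
  Bounded v vs L = N ≤ v × All (_< v) vs × All (λ A → All (_< v) (vars A)) L

  ∉φ : ∀ {v} → N ≤ v → v ∉ vars φ
  ∉φ N≤v = <⇒∉ (All.tabulate (λ y∈ → ℕ.<-≤-trans (φ<N y∈) N≤v))

  ∉pvars : ∀ {v vs L} → Bounded v vs L → v ∉ pvars (extended vs)
  ∉pvars {v} {vs} (N≤v , vs<v , _) = subst (v ∉_) (sym (pvars-extended vs))
    (<⇒∉ (All.++⁺ (All.tabulate (below ∘ U<N)) (All.++⁺ (All.tabulate (below ∘ X<N)) vs<v)))
    where
    below : ∀ {y} → y < N → y < v
    below y<N = ℕ.<-≤-trans y<N N≤v

  indicatorLine-bounded : ∀ {v x α} → N ≤ v → ValidCopy (x , α) →
                          All (_< suc v) (vars (indicatorLine v (x , α)))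
  indicatorLine-bounded {v} {x} {α} N≤v (x∈X , α∈) =
    All.++⁺ (All.tabulate (below ∘ U<N ∘ Dep⊆U x ∘ α⊆Dep ∘ vars-bigAnd α))
            (ℕ.n<1+n v ∷ below (X<N x∈X) ∷ [])
    where
    α⊆Dep : map proj₁ α ⊆ Dep x
    α⊆Dep = subst (_ ∈_) (vars-minterms (Dep x) α∈)
    below : ∀ {y} → y < N → y < suc v
    below y<N = ℕ.m<n⇒m<1+n (ℕ.<-≤-trans y<N N≤v)

  introduce-indicator : ∀ {v vs L x α} → ValidCopy (x , α) → Bounded v vs L →
                        Deriv F Q (extended vs) L →
                        Deriv F Q (extended (vs ++ v ∷ [])) (indicatorLine v (x , α) ∷ L)
  introduce-indicator {v} {vs} {L} {x} {α} (x∈X , α∈) bounded@(N≤v , _ , L<v) d =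
    subst (λ P → Deriv F Q P (indicatorLine v (x , α) ∷ L)) extended-by-v
      (indExtAnd d α α⊆U ((x , true) ∷ []) (x∈pvars ∷ []) v (∉pvars bounded) (∉φ N≤v) (All.map <⇒∉ L<v))
    where
    α-vars : map proj₁ α ≡ Dep x
    α-vars = vars-minterms (Dep x) α∈
    α⊆U : All (λ l → proj₁ l ∈ U) α
    α⊆U = All.map⁻ (subst (All (_∈ U)) (sym α-vars) (All.tabulate (Dep⊆U x)))
    x∈pvars : x ∈ pvars (extended vs)
    x∈pvars = subst (x ∈_) (sym (pvars-extended vs)) (∈-++⁺ʳ U (∈-++⁺ˡ x∈X))
    no-deps : removeAll (map proj₁ α) (depsOf (extended vs) x ++ []) ≡ []
    no-deps = trans (cong₂ removeAll α-vars (trans (List.++-identityʳ _) (depsOf-extended vs x∈X)))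
                    (removeAll-⊆ {Dep x} id)
    extended-by-v : addE (extended vs) v (removeAll (map proj₁ α) (depsOf (extended vs) x ++ []))
                    ≡ extended (vs ++ v ∷ [])
    extended-by-v = trans (cong (addE (extended vs) v) no-deps) (extended-snoc vs v)

  record Indicators (L₀ : List Form) (v : ℕ) (cs : List Copy) : Set where
    field
      names       : List ℕ
      lines       : List Form
      deriv       : Deriv F Q (extended names) lines
      keeps       : L₀ ⊆ lines
      introduced  : ∀ {c} → c ∈ cs → indicatorLine (v + position c cs) c ∈ lines
      fresh       : ℕ
      fresh∉pvars : fresh ∉ pvars (extended names)
      fresh∉φ     : fresh ∉ vars φ

  indicators-∷ : ∀ {L v c cs} → Indicators (indicatorLine v c ∷ L) (suc v) cs → Indicators L v (c ∷ cs)
  indicators-∷ {L} {v} {c} {cs} r = record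
    { names = names ; lines = lines ; deriv = deriv ; keeps = keeps ∘ there ; introduced = introduced′
    ; fresh = fresh ; fresh∉pvars = fresh∉pvars ; fresh∉φ = fresh∉φ }
    where
    open Indicators r
    introduced′ : ∀ {c′} → c′ ∈ c ∷ cs → indicatorLine (v + position c′ (c ∷ cs)) c′ ∈ lines
    introduced′ {c′} c′∈ with c′ ≟ᶜ c
    ... | yes refl = subst (λ n → indicatorLine n c′ ∈ lines) (sym (ℕ.+-identityʳ v)) (keeps (here refl))
    ... | no  c′≢c = subst (λ n → indicatorLine n c′ ∈ lines) (sym (ℕ.+-suc v _))
                           (introduced (Any.tail c′≢c c′∈))

  introduce-indicators : ∀ cs {v vs L} → All ValidCopy cs → Bounded v vs L → Deriv F Q (extended vs) L →
                         Indicators L v cs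
  introduce-indicators [] {v} {vs} {L} _ bounded@(N≤v , _) d = record
    { names = vs ; lines = L ; deriv = d ; keeps = id ; introduced = λ ()
    ; fresh = v ; fresh∉pvars = ∉pvars bounded ; fresh∉φ = ∉φ N≤v }
  introduce-indicators (c ∷ cs) {v} (valid ∷ valids) bounded@(N≤v , vs<v , L<v) d =
    indicators-∷ (introduce-indicators cs valids bounded′ (introduce-indicator valid bounded d))
    where
    bounded′ : Bounded (suc v) _ (indicatorLine v c ∷ _)
    bounded′ = ℕ.m≤n⇒m≤1+n N≤v
             , All.++⁺ (All.map ℕ.m<n⇒m<1+n vs<v) (ℕ.n<1+n v ∷ [])
             , indicatorLine-bounded N≤v valid ∷ All.map (All.map ℕ.m<n⇒m<1+n) L<v

  initial : Deriv F Q (extended []) (conjuncts φ)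
  initial = subst (λ E′ → Deriv F Q (pfx U E′) (conjuncts φ)) (sym (List.++-identityʳ E)) (axioms id)

  initial-bounded : Bounded N [] (conjuncts φ)
  initial-bounded = ℕ.≤-refl , [] , All.tabulate (λ c∈ → All.tabulate (φ<N ∘ vars-conjuncts φ c∈))

  IndicatorsIn : List Form → Set
  IndicatorsIn L = ∀ {c} → c ∈ copies → indicatorLine (indicator c) c ∈ L

  instantiate : Assignment → ℕ → Maybe (List ℕ) → Form
  instantiate g x (just D) = var (indicator (x , minterm D g))
  instantiate g x nothing  = var x

  expansion : Assignment → Form
  expansion g = bigAnd (map lit (minterm U g)) ⇒ᶠ inst (λ x → instantiate g x (lookupDep E x)) φ

  reducedExpansion : Assignment → Form
  reducedExpansion g = setVars (minterm U g) (expansion g)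

  expansion-entailed : ∀ g {L} → conjuncts φ ⊆ L → IndicatorsIn L → L ⊨ expansion g
  expansion-entailed g φ⊆L indicators ρ ρ⊨L =
    ⇒ᶠ-intro (bigAnd (map lit (minterm U g))) (inst σ φ) ρ λ g-true → begin
      ⟦ inst σ φ ⟧ ρ            ≡⟨ ⟦inst⟧ σ φ ρ ⟩
      ⟦ φ ⟧ (λ y → ⟦ σ y ⟧ ρ)   ≡⟨ ⟦⟧-local φ (λ {y} _ → indicator-value (⟦bigAnd⟧⁻ _ ρ g-true) y _ refl) ⟩
      ⟦ φ ⟧ ρ                   ≡⟨ ⟦conjuncts⟧ φ ρ (All.tabulate (All.lookup ρ⊨L ∘ φ⊆L)) ⟩
      true                      ∎
    where
    σ : ℕ → Form
    σ x = instantiate g x (lookupDep E x)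
    indicator-value : Agrees ρ (minterm U g) → ∀ y m → lookupDep E y ≡ m → ⟦ instantiate g y m ⟧ ρ ≡ ρ y
    indicator-value ρ⊨g y nothing  _  = refl
    indicator-value ρ⊨g y (just D) eq =
      indicatorLine-value ρ _ y (minterm D g) (All.lookup ρ⊨L (indicators copy∈)) ρ⊨g|D
      where
      copy∈ : (y , minterm D g) ∈ copies
      copy∈ = subst (λ D → (y , minterm D g) ∈ copies) (Dep-just eq) (∈-copies⁺ g (lookupDep⇒∈X eq))
      ρ⊨g|D : Agrees ρ (minterm D g)
      ρ⊨g|D = All.map⁺ (All.tabulate (All.lookup (All.map⁻ ρ⊨g) ∘ lookupDep⇒⊆U eq))

  expansion-avoids-X : ∀ g → All (_∉ X) (vars (expansion g))
  expansion-avoids-X g =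
    All.++⁺ (All.tabulate (U∩X ∘ subst (_ ∈_) (vars-minterm U g) ∘ vars-bigAnd (minterm U g)))
            (vars-inst _ φ (λ {z} _ → instantiate-avoids z (lookupDep E z) refl))
    where
    instantiate-avoids : ∀ z m → lookupDep E z ≡ m → All (_∉ X) (vars (instantiate g z m))
    instantiate-avoids z (just D) _  = indicator∉X _ ∷ []
    instantiate-avoids z nothing  eq = lookupDep-∉ E eq ∷ []

  unconstrained : ∀ vs {A} → All (_∉ X) (vars A) → Unconstrained (extended vs) A
  unconstrained vs A∌X x∈A eq =
    lookupDep-independent vs (trans (sym (lookupDep-++ʳ E _ (All.lookup A∌X x∈A))) eq)

  derive-reduced-expansion : ∀ {vs L₀} → conjuncts φ ⊆ L₀ → IndicatorsIn L₀ → ∀ α {L} → L₀ ⊆ L →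
                             Deriv F Q (extended vs) L →
                             Extension (extended vs) L (reducedExpansion (valuation α) ∈_)
  derive-reduced-expansion φ⊆L₀ indicators α L₀⊆L d =
    derive-entailed d (expansion-entailed g (L₀⊆L ∘ φ⊆L₀) (L₀⊆L ∘ indicators)) ⟫= λ _ d′ expansion∈ →
    ∀red-all (minterm U g) (All.map⁺ (All.tabulate id))
             (unconstrained _ {expansion g} (expansion-avoids-X g)) expansion∈ d′
    where
    g : Assignment
    g = valuation α

  skolem : Assignment → ℕ → Assignment → Bool
  skolem ρ x β = ρ (indicator (x , minterm (Dep x) β))

  skolem-satisfies : ∀ ρ τ → ⟦ reducedExpansion (valuation (minterm U τ)) ⟧ ρ ≡ true →
                     ⟦ φ ⟧ (extend E (skolem ρ) τ) ≡ true
  skolem-satisfies ρ τ reduced = begin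
    ⟦ φ ⟧ (extend E (skolem ρ) τ)   ≡⟨ ⟦⟧-local φ (λ {y} → same y) ⟩
    ⟦ φ ⟧ (λ y → ⟦ σ y ⟧ ρ′)        ≡⟨ sym (⟦inst⟧ σ φ ρ′) ⟩
    ⟦ inst σ φ ⟧ ρ′                 ≡⟨ ⇒ᶠ-elim (bigAnd (map lit (minterm U g))) (inst σ φ) ρ′
                                                expansion-true g-true ⟩
    true                            ∎
    where
    g : Assignment
    g = valuation (minterm U τ)
    σ : ℕ → Form
    σ x = instantiate g x (lookupDep E x)
    ρ′ : Assignment
    ρ′ = override (minterm U g) ρ
    g≈τ : ∀ {u} → u ∈ U → g u ≡ τ u
    g≈τ = override-minterm-∈ U τ _
    ρ′≈g : ∀ {u} → u ∈ U → ρ′ u ≡ g u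
    ρ′≈g = override-minterm-∈ U g ρ
    expansion-true : ⟦ expansion g ⟧ ρ′ ≡ true
    expansion-true = trans (sym (⟦setVars⟧ (minterm U g) (expansion g) ρ)) reduced
    g-true : ⟦ bigAnd (map lit (minterm U g)) ⟧ ρ′ ≡ true
    g-true = ⟦bigAnd⟧⁺ (minterm U g) ρ′ (All.map⁺ (All.tabulate ρ′≈g))
    same : ∀ y → y ∈ vars φ → extend E (skolem ρ) τ y ≡ ⟦ σ y ⟧ ρ′
    same y y∈φ with lookupDep E y in eq
    ... | just D = begin
      ρ (indicator (y , minterm (Dep y) (restrict D τ)))  ≡⟨ cong (λ α → ρ (indicator (y , α))) restricted ⟩
      ρ (indicator (y , minterm D g))                     ≡⟨ override-minterm-∉ U g ρ (indicator∉U _) ⟨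
      ρ′ (indicator (y , minterm D g))                    ∎
      where
      restricted : minterm (Dep y) (restrict D τ) ≡ minterm D g
      restricted = trans (cong (λ D′ → minterm D′ (restrict D τ)) (Dep-just eq))
        (List.map-cong-local (All.tabulate (λ u∈D →
          cong (_ ,_) (trans (restrict-∈ τ u∈D) (sym (g≈τ (lookupDep⇒⊆U eq u∈D)))))))
    ... | nothing with ∈-++⁻ U (All.lookup (proj₂ (proj₂ wf)) y∈φ)
    ...   | inj₁ y∈U = sym (trans (ρ′≈g y∈U) (g≈τ y∈U))
    ...   | inj₂ y∈X = ⊥-elim (lookupDep-∉ E eq y∈X)

  ReducedExpansionsIn : List Form → Set
  ReducedExpansionsIn L = All (λ α → reducedExpansion (valuation α) ∈ L) (minterms U)

  reduced-expansions-inconsistent : ¬ IsTrue Q → ∀ {L} → ReducedExpansionsIn L → L ⊨ cst false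
  reduced-expansions-inconsistent falseQ reduced∈L ρ ρ⊨L = ⊥-elim (falseQ (skolem ρ , λ τ →
    skolem-satisfies ρ τ (All.lookup ρ⊨L (All.lookup reduced∈L (minterm∈minterms U τ)))))

corollary1 : (F : FregeSystem) (Q : DQBF) → WellFormed Q → ¬ IsTrue Q → Refutation F Q
corollary1 F Q wf falseQ =
  refutation fresh fresh∉pvars fresh∉φ (Extension.deriv refuted) (Extension.goal refuted)
  where
  open Derivations F Q
  open Expansion F Q wf
  open Indicators (introduce-indicators copies (All.tabulate ∈-copies⁻) initial-bounded initial)
  expanded : Extension (extended names) lines ReducedExpansionsIn
  expanded = derive-each _ (derive-reduced-expansion keeps introduced) (minterms U) id deriv
  refuted : Extension (extended names) (Extension.lines expanded) (cst false ∈_)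
  refuted = derive-entailed (Extension.deriv expanded)
                            (reduced-expansions-inconsistent falseQ (Extension.goal expanded))
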